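{- Let $3\le k_1<k_2$ be integers and $n$ a positive integer. If $\nu_{k_2}(n+k_2-3)=0$, then $\nu_{k_1}(n+k_1-3)=0$.
   Context: For an integer $k\ge 3$ and a positive integer $m$, $\nu_k(m)$ denotes the number of $k$-tuples of integers $(x_1,\dots,x_k)$ with $1\le x_1\le x_2\le\dots\le x_k$ such that $m = x_1x_2\cdots x_k + x_1+x_2+\dots+x_k$. -}

module Defs where

open import Data.Nat using (ℕ; zero; suc; _+_; _*_; _∸_; _≟_)
open import Data.List using (List; []; _∷_; map; concatMap; upTo; length; filter)
open import Data.Nat.ListAction using (sum; product)
open import Relation.Binary.PropositionalEquality using (_≡_)

ndTuples : ℕ → ℕ → ℕ → List (List ℕ)
ndTuples zero    lo b = [] ∷ []
ndTuples (suc j) lo b =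
  concatMap (λ x → map (x ∷_) (ndTuples j x b))
            (map (lo +_) (upTo (suc b ∸ lo)))

-- Any solution has every x_i ≤ m (since x_i ≤ x₁+…+x_k < m), so enumerating
-- tuples with entries in [1, m] counts all of them.
ν : ℕ → ℕ → ℕ
ν k m = length (filter (λ xs → m ≟ product xs + sum xs) (ndTuples k 1 m))

{-# OPTIONS --safe #-}
module Submission where

-- Prepending a 1 to a solution of m = x₁⋯x_k + x₁ + … + x_k keeps the product and
-- raises the sum by one, so a solution for (k, m) yields one for (k + 1, m + 1).
-- Applying this k₂ − k₁ times carries a solution for (k₁, n + k₁ − 3) to one for
-- (k₂, n + k₂ − 3).

open import Defs
open import Data.Nat using (ℕ; zero; suc; _+_; _∸_; _≤_; _<_; s≤s; z≤n; _≟_)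
open import Data.Nat.Properties
open import Data.Nat.ListAction using (sum; product)
open import Data.List using (List; _∷_; map; upTo; filter)
open import Data.List.Membership.Propositional using (_∈_; find; lose)
open import Data.List.Membership.Propositional.Properties
open import Data.List.Relation.Unary.Any using (here)
open import Data.List.Properties using (filter-some)
open import Data.Product using (∃; _,_; _×_)
open import Data.Empty using (⊥-elim)
open import Relation.Nullary using (Dec; yes; no)
open import Algebra.Properties.CommutativeSemigroup +-commutativeSemigroup using (x∙yz≈y∙xz)
open import Relation.Binary.PropositionalEquality

solves? : (m : ℕ) (xs : List ℕ) → Dec (m ≡ product xs + sum xs)
solves? m xs = m ≟ product xs + sum xs

Solution : ℕ → ℕ → List ℕ → Set
Solution k m xs = xs ∈ ndTuples k 1 m × m ≡ product xs + sum xs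

ndTuples-mono : ∀ j lo {b b′ xs} → b ≤ b′ → xs ∈ ndTuples j lo b → xs ∈ ndTuples j lo b′
ndTuples-mono zero    lo b≤b′ xs∈ = xs∈
ndTuples-mono (suc j) lo {b} {b′} b≤b′ xs∈
  with x , x∈ , xs∈x ← find (∈-concatMap⁻ (λ x → map (x ∷_) (ndTuples j x b))
                                         {xs = map (lo +_) (upTo (suc b ∸ lo))} xs∈)
  with i , i∈ , refl ← ∈-map⁻ (lo +_) x∈
  with ys , ys∈ , refl ← ∈-map⁻ ((lo + i) ∷_) xs∈x
  = ∈-concatMap⁺ (λ x → map (x ∷_) (ndTuples j x b′))
      (lose (∈-map⁺ (lo +_) (∈-upTo⁺ (<-≤-trans (∈-upTo⁻ i∈) (∸-monoˡ-≤ lo (s≤s b≤b′)))))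
            (∈-map⁺ ((lo + i) ∷_) (ndTuples-mono j (lo + i) b≤b′ ys∈)))

1∷-∈-ndTuples : ∀ j {b xs} → 0 < b → xs ∈ ndTuples j 1 b → (1 ∷ xs) ∈ ndTuples (suc j) 1 b
1∷-∈-ndTuples j {b} 0<b xs∈ =
  ∈-concatMap⁺ (λ x → map (x ∷_) (ndTuples j x b))
    (lose (∈-map⁺ (1 +_) (∈-upTo⁺ 0<b)) (∈-map⁺ (1 ∷_) xs∈))

solution-suc : ∀ k {m xs} → Solution k m xs → Solution (suc k) (suc m) (1 ∷ xs)
solution-suc k {m} {xs} (xs∈ , m≡) =
  1∷-∈-ndTuples k (s≤s z≤n) (ndTuples-mono k 1 (n≤1+n m) xs∈) , suc-m≡
  where
  suc-m≡ : suc m ≡ product (1 ∷ xs) + sum (1 ∷ xs)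
  suc-m≡ = begin
    suc m                         ≡⟨ cong suc m≡ ⟩
    suc (product xs + sum xs)     ≡⟨ sym (+-suc (product xs) (sum xs)) ⟩
    product xs + suc (sum xs)     ≡⟨ cong (_+ suc (sum xs)) (sym (+-identityʳ (product xs))) ⟩
    product (1 ∷ xs) + sum (1 ∷ xs) ∎
    where open ≡-Reasoning

ν-pos⇒solution : ∀ k m → 0 < ν k m → ∃ (Solution k m)
ν-pos⇒solution k m ν>0 with filter (solves? m) (ndTuples k 1 m) in eq
... | xs ∷ _ = xs , ∈-filter⁻ (solves? m) (subst (xs ∈_) (sym eq) (here refl))

solution⇒ν-pos : ∀ k {m xs} → Solution k m xs → 0 < ν k m
solution⇒ν-pos k {m} (xs∈ , m≡) =
  filter-some (solves? m) (lose xs∈ m≡)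

ν-pos-shift : ∀ d {k m} → 0 < ν k m → 0 < ν (d + k) (d + m)
ν-pos-shift zero    ν>0 = ν>0
ν-pos-shift (suc d) {k} {m} ν>0
  with xs , sol ← ν-pos⇒solution (d + k) (d + m) (ν-pos-shift d ν>0)
  = solution⇒ν-pos (suc (d + k)) (solution-suc (d + k) sol)

corollary2 : (k₁ k₂ n : ℕ) → 3 ≤ k₁ → k₁ < k₂ → 1 ≤ n →
    ν k₂ (n + k₂ ∸ 3) ≡ 0 → ν k₁ (n + k₁ ∸ 3) ≡ 0
corollary2 k₁ k₂ n 3≤k₁ k₁<k₂ _ ν₂≡0 with ν k₁ (n + k₁ ∸ 3) ≟ 0
... | yes ν₁≡0 = ν₁≡0
... | no  ν₁≢0 = ⊥-elim (<-irrefl (sym ν₂≡0) ν₂>0)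
  where
  d = k₂ ∸ k₁
  k≡k₂ : d + k₁ ≡ k₂
  k≡k₂ = m∸n+n≡m (<⇒≤ k₁<k₂)
  m≡m₂ : d + (n + k₁ ∸ 3) ≡ n + k₂ ∸ 3
  m≡m₂ = begin
    d + (n + k₁ ∸ 3)   ≡⟨ sym (+-∸-assoc d (≤-trans 3≤k₁ (m≤n+m k₁ n))) ⟩
    d + (n + k₁) ∸ 3   ≡⟨ cong (_∸ 3) (x∙yz≈y∙xz d n k₁) ⟩
    n + (d + k₁) ∸ 3   ≡⟨ cong (λ k → n + k ∸ 3) k≡k₂ ⟩
    n + k₂ ∸ 3         ∎
    where open ≡-Reasoning
  ν₂>0 : 0 < ν k₂ (n + k₂ ∸ 3)
  ν₂>0 = subst₂ (λ k m → 0 < ν k m) k≡k₂ m≡m₂ (ν-pos-shift d (n≢0⇒n>0 ν₁≢0))
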